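{- For any Boolean matrices $K \in \{0,1\}^{m_1\times n_1}$ and $M \in \{0,1\}^{m_2\times n_2}$, we have $\mathsf{OR}(K \otimes M) \ge \mathsf{rk_\lor^*}(K) \cdot \mathsf{OR}(M)$.
   Context: The Kronecker product $K\otimes M$ is the $(m_1m_2)\times(n_1n_2)$ Boolean matrix with rows indexed by pairs $(i_1,i_2)$, columns by pairs $(j_1,j_2)$, and entry $K_{i_1,j_1}\cdot M_{i_2,j_2}$. A rectifier network with $m$ inputs and $n$ outputs is a tuple $(V,E,\mathsf{in},\mathsf{out})$ where $(V,E)$ is a directed acyclic graph and $\mathsf{in}\colon\{1,\dots,n\}\to V$, $\mathsf{out}\colon\{1,\dots,m\}\to V$ are injective maps whose images consist only of sources (respectively, only of sinks); its size is $|E|$; it expresses the Boolean $m\times n$ matrix with entry $(i,j)$ equal to $1$ iff there is a directed path from $\mathsf{in}(j)$ to $\mathsf{out}(i)$. $\mathsf{OR}(A)$ is the smallest size of any rectifier network expressing $A$. A 1-rectangle of $K$ is a pair $(R,C)$ of a set of row indices and a set of column indices with $K_{ij}=1$ for all $(i,j)\in R\times C$. The fractional rank $\mathsf{rk_\lor^*}(K)$ is the optimal value of the linear program: minimize $\sum_{(R,C)} x_{(R,C)}$ over real $x_{(R,C)}\in[0,1]$ indexed by the 1-rectangles of $K$, subject to $\sum_{(R,C)\ni(i,j)} x_{(R,C)} \ge 1$ for every $(i,j)$ with $K_{ij}=1$.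
   Formalization: The variables $x_{(R,C)}$ of the linear program defining $\mathsf{rk_\lor^*}(K)$ are rational rather than real. -}

module Defs where

open import Data.Nat using (ℕ; zero; suc) renaming (_*_ to _*ℕ_)
open import Data.Bool using (Bool; true; false; _∧_; _∨_; not)
open import Data.Fin using (Fin; remQuot)
open import Data.Fin.Subset using (Subset)
open import Data.Vec using (Vec; []; _∷_; lookup)
open import Data.List using (List; []; _∷_; length; map; concatMap; filter; allFin; foldr)
open import Data.Bool.ListAction using (all)
open import Data.List.Membership.Propositional using (_∈_)
open import Data.List.Relation.Unary.Unique.Propositional using (Unique)
open import Data.Product using (_×_; _,_; proj₁; proj₂)
open import Data.Integer using (+_)
open import Data.Rational using (ℚ; _+_; _≤_; 0ℚ; 1ℚ)
open import Relation.Binary.PropositionalEquality using (_≡_; _≢_)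
open import Relation.Binary.Construct.Closure.ReflexiveTransitive using (Star)
open import Relation.Binary.Construct.Closure.Transitive using (TransClosure)
open import Function.Definitions using (Injective)
open import Function.Bundles using (_⇔_)
open import Data.Empty using (⊥)
open import Relation.Nullary using (¬_)

BMat : ℕ → ℕ → Set
BMat m n = Fin m → Fin n → Bool

-- Kronecker product; the index (i₁ , i₂) of Fin m₁ × Fin m₂ is encoded
-- in Fin (m₁ * m₂) via the standard bijection remQuot / combine.
_⊗_ : ∀ {m₁ n₁ m₂ n₂} → BMat m₁ n₁ → BMat m₂ n₂ → BMat (m₁ *ℕ m₂) (n₁ *ℕ n₂)
_⊗_ {m₁} {n₁} {m₂} {n₂} K M i j =
  K (proj₁ (remQuot {m₁} m₂ i)) (proj₁ (remQuot {n₁} n₂ j))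
  ∧ M (proj₂ (remQuot {m₁} m₂ i)) (proj₂ (remQuot {n₁} n₂ j))

record Network (m n : ℕ) : Set where
  field
    nv      : ℕ
    edges   : List (Fin nv × Fin nv)     -- E, edge (u , w) means u → w
    uniqueE : Unique edges               -- E is a set
  Edge : Fin nv → Fin nv → Set
  Edge u w = (u , w) ∈ edges
  field
    acyclic : ∀ u → ¬ TransClosure Edge u u
    inp     : Fin n → Fin nv
    out     : Fin m → Fin nv
    inpInj  : Injective _≡_ _≡_ inp
    outInj  : Injective _≡_ _≡_ out
    inpSrc  : ∀ j u → ¬ Edge u (inp j)
    outSnk  : ∀ i w → ¬ Edge (out i) w

  size : ℕ
  size = length edges

  Expresses : BMat m n → Set
  Expresses A = ∀ i j → (A i j ≡ true) ⇔ Star Edge (inp j) (out i)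

open Network public

IsOR : ∀ {m n} → BMat m n → ℕ → Set
IsOR {m} {n} A s =
  (Data.Product.Σ (Network m n) λ N → Expresses N A × size N ≡ s)
  × (∀ (N : Network m n) → Expresses N A → s Data.Nat.≤ size N)

allSubsets : ∀ n → List (Subset n)
allSubsets zero = [] ∷ []
allSubsets (suc n) = concatMap (λ s → (true ∷ s) ∷ (false ∷ s) ∷ []) (allSubsets n)

is1Rect : ∀ {m n} → BMat m n → Subset m → Subset n → Bool
is1Rect {m} {n} K R C =
  all (λ i → all (λ j → not (lookup R i ∧ lookup C j) ∨ K i j) (allFin n)) (allFin m)

rects : ∀ {m n} → BMat m n → List (Subset m × Subset n)
rects {m} {n} K =
  filter (λ rc → is1Rect K (proj₁ rc) (proj₂ rc) Data.Bool.≟ true)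
         (concatMap (λ R → map (λ C → (R , C)) (allSubsets n)) (allSubsets m))

sumℚ : List ℚ → ℚ
sumℚ = foldr _+_ 0ℚ

-- a weight vector x indexed by 1-rectangles (values outside rects K are ignored)
Weights : ℕ → ℕ → Set
Weights m n = Subset m → Subset n → ℚ

objective : ∀ {m n} → BMat m n → Weights m n → ℚ
objective K x = sumℚ (map (λ rc → x (proj₁ rc) (proj₂ rc)) (rects K))

Feasible : ∀ {m n} → BMat m n → Weights m n → Set
Feasible {m} {n} K x =
  (∀ rc → rc ∈ rects K → (0ℚ ≤ x (proj₁ rc) (proj₂ rc)) × (x (proj₁ rc) (proj₂ rc) ≤ 1ℚ))
  × (∀ (i : Fin m) (j : Fin n) → K i j ≡ true →
       1ℚ ≤ sumℚ (map (λ rc → if lookup (proj₁ rc) i ∧ lookup (proj₂ rc) j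
                                then x (proj₁ rc) (proj₂ rc) else 0ℚ) (rects K)))
  where open Data.Bool using (if_then_else_)

IsFracRank : ∀ {m n} → BMat m n → ℚ → Set
IsFracRank {m} {n} K r =
  (Data.Product.Σ (Weights m n) λ x → Feasible K x × objective K x ≡ r)
  × (∀ (x : Weights m n) → Feasible K x → r ≤ objective K x)

ℕtoℚ : ℕ → ℚ
ℕtoℚ k = (+ k) Data.Rational./ 1

-- Take a network N for K ⊗ M of minimum size. To an edge u → w attach the pair (R , C)
-- where R holds the rows i₁ for which w reaches some output (i₁ , i₂) and C the columns j₁
-- for which some input (j₁ , j₂) reaches u; a path through the edge realises the entry
-- K i₁ j₁ ∧ M i₂ j₂, so (R , C) is a 1-rectangle of K. For a 1-entry (i₁ , j₁) of K the edges
-- whose rectangle contains (i₁ , j₁) already form a network for M between the inputs (j₁ , ·)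
-- and the outputs (i₁ , ·), so there are at least OR(M) of them. Weighting every 1-rectangle
-- by min(1 , multiplicity / OR(M)) is therefore feasible for the LP, with value at most
-- size N / OR(M).

module Submission where

open import Defs
open import Data.Bool using (Bool; true; false; _∧_; _∨_; not; if_then_else_)
open import Data.Bool.ListAction using (all)
import Data.Bool.Properties as Bool
open import Data.Fin as Fin using (Fin; toℕ; combine)
import Data.Fin.Properties as Fin
open import Data.Fin.Subset using (Subset)
open import Data.Integer as ℤ using (+_; +[1+_])
import Data.Integer.Properties as ℤ
open import Data.List
  using (List; []; _∷_; _++_; map; length; filter; filterᵇ; concatMap; allFin;
         cartesianProductWith; cartesianProduct)
open import Data.List.Properties using (map-cong; length-filter)
open import Data.List.Membership.Propositional using (_∈_; find; lose)
open import Data.List.Membership.Propositional.Properties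
  using (∈-filter⁺; ∈-filter⁻; ∈-cartesianProductWith⁺; ∈-cartesianProduct⁺)
open import Data.List.Relation.Unary.All as All using (All; []; _∷_)
open import Data.List.Relation.Unary.AllPairs using ([]; _∷_)
open import Data.List.Relation.Unary.Any using (Any; any?; here; there)
open import Data.List.Relation.Unary.Unique.Propositional using (Unique)
open import Data.List.Relation.Unary.Unique.Propositional.Properties
  using (filter⁺; cartesianProductWith⁺; cartesianProduct⁺)
open import Data.Nat as ℕ using (ℕ; zero; suc; z≤n; s≤s) renaming (_*_ to _*ℕ_)
import Data.Nat.Properties as ℕ
open import Algebra.Properties.CommutativeSemigroup ℕ.+-commutativeSemigroup using (interchange)
open import Data.Nat.Coprimality as Coprimality using (Coprime; 1-coprimeTo)
open import Data.Nat.ListAction using (sum)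
open import Data.Product using (_×_; _,_; proj₁; proj₂; ∃)
import Data.Product.Properties as Product
open import Data.Rational using (ℚ; mkℚ; _/_; _≤_; _+_; _*_; _⊓_; 1/_; 0ℚ; 1ℚ; *≤*; nonNegative)
open import Data.Rational.Properties
  using (normalize-coprime; nonNegative⁻¹; *-inverseʳ; *-assoc; *-comm; *-identityʳ;
         *-zeroˡ; *-zeroʳ; *-distribʳ-+; *-monoʳ-≤-nonNeg; +-identityˡ; +-identityʳ;
         +-mono-≤; +-monoˡ-≤; +-monoʳ-≤; ≤-refl; ≤-trans; ≤-reflexive; ≤-total;
         ⊓-glb; p⊓q≤p; p⊓q≤q; p≤q⇒p⊓q≡p; p≥q⇒p⊓q≡q; module ≤-Reasoning)
open import Data.Sum using (_⊎_; inj₁; inj₂)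
import Data.Vec as Vec
open Vec using ([]; _∷_; lookup; tabulate)
import Data.Vec.Properties as Vec
open import Function using (_∘_; flip; _⇔_; mk⇔; Equivalence)
open import Function.Definitions using (Injective)
open import Relation.Nullary using (¬_; Dec; does; yes; no; contradiction)
open import Relation.Nullary.Decidable using (_⊎-dec_; _×-dec_; map′; dec-true; T?)
open import Relation.Binary.Definitions using (Decidable; DecidableEquality)
open import Relation.Binary.PropositionalEquality
open import Relation.Binary.Construct.Closure.ReflexiveTransitive as Star
  using (Star; ε; _◅_; _◅◅_)
open import Relation.Binary.Construct.Closure.Transitive using (TransClosure; [_]; _∷_)

coprime-1 : ∀ k → Coprime k 1
coprime-1 k = Coprimality.sym (1-coprimeTo k)

ℕtoℚ≡mkℚ : ∀ k → ℕtoℚ k ≡ mkℚ (+ k) 0 (coprime-1 k)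
ℕtoℚ≡mkℚ k = normalize-coprime (coprime-1 k)

-- The middle term is the unfolding of the sum of the canonical forms mkℚ (+ m) 0 _ and mkℚ (+ n) 0 _.
ℕtoℚ-+ : ∀ m n → ℕtoℚ (m ℕ.+ n) ≡ ℕtoℚ m + ℕtoℚ n
ℕtoℚ-+ m n = begin
  + (m ℕ.+ n) / 1
    ≡⟨ cong (_/ 1) (cong₂ ℤ._+_ (ℤ.*-identityʳ (+ m)) (ℤ.*-identityʳ (+ n))) ⟨
  (+ m ℤ.* + 1 ℤ.+ + n ℤ.* + 1) / 1
    ≡⟨ cong₂ _+_ (ℕtoℚ≡mkℚ m) (ℕtoℚ≡mkℚ n) ⟨
  ℕtoℚ m + ℕtoℚ n
    ∎
  where open ≡-Reasoning

ℕtoℚ-mono-≤ : ∀ {m n} → m ℕ.≤ n → ℕtoℚ m ≤ ℕtoℚ n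
ℕtoℚ-mono-≤ {m} {n} m≤n rewrite ℕtoℚ≡mkℚ m | ℕtoℚ≡mkℚ n =
  *≤* (ℤ.*-monoʳ-≤-nonNeg (+ 1) (ℤ.+≤+ m≤n))

0≤ℕtoℚ : ∀ k → 0ℚ ≤ ℕtoℚ k
0≤ℕtoℚ k = ℕtoℚ-mono-≤ {0} {k} z≤n

1/[1+_] : ℕ → ℚ
1/[1+ n ] = 1/ mkℚ +[1+ n ] 0 (coprime-1 (suc n))

ℕtoℚ[1+n]*1/[1+n]≡1 : ∀ n → ℕtoℚ (suc n) * 1/[1+ n ] ≡ 1ℚ
ℕtoℚ[1+n]*1/[1+n]≡1 n rewrite ℕtoℚ≡mkℚ (suc n) =
  *-inverseʳ (mkℚ +[1+ n ] 0 (coprime-1 (suc n)))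

≤*1/[1+n]⇒*[1+n]≤ : ∀ {p q} n → p ≤ q * 1/[1+ n ] → p * ℕtoℚ (suc n) ≤ q
≤*1/[1+n]⇒*[1+n]≤ {p} {q} n p≤q/[1+n] = begin
  p * ℕtoℚ (suc n)
    ≤⟨ *-monoʳ-≤-nonNeg (ℕtoℚ (suc n)) {{nonNegative (0≤ℕtoℚ (suc n))}} p≤q/[1+n] ⟩
  q * 1/[1+ n ] * ℕtoℚ (suc n)
    ≡⟨ *-assoc q _ _ ⟩
  q * (1/[1+ n ] * ℕtoℚ (suc n))
    ≡⟨ cong (q *_) (trans (*-comm 1/[1+ n ] (ℕtoℚ (suc n))) (ℕtoℚ[1+n]*1/[1+n]≡1 n)) ⟩
  q * 1ℚ
    ≡⟨ *-identityʳ q ⟩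
  q
    ∎
  where open ≤-Reasoning

⊓-subadditive : ∀ {p u v} → 0ℚ ≤ p → 0ℚ ≤ u → 0ℚ ≤ v → p ⊓ (u + v) ≤ p ⊓ u + p ⊓ v
⊓-subadditive {p} {u} {v} 0≤p 0≤u 0≤v with ≤-total p u | ≤-total p v
... | inj₁ p≤u | _ rewrite p≤q⇒p⊓q≡p p≤u = begin
  p ⊓ (u + v)   ≤⟨ p⊓q≤p p (u + v) ⟩
  p             ≡⟨ +-identityʳ p ⟨
  p + 0ℚ        ≤⟨ +-monoʳ-≤ p (⊓-glb 0≤p 0≤v) ⟩
  p + p ⊓ v     ∎
  where open ≤-Reasoning
... | inj₂ u≤p | inj₁ p≤v rewrite p≤q⇒p⊓q≡p p≤v = begin
  p ⊓ (u + v)   ≤⟨ p⊓q≤p p (u + v) ⟩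
  p             ≡⟨ +-identityˡ p ⟨
  0ℚ + p        ≤⟨ +-monoˡ-≤ p (⊓-glb 0≤p 0≤u) ⟩
  p ⊓ u + p     ∎
  where open ≤-Reasoning
... | inj₂ u≤p | inj₂ v≤p rewrite p≥q⇒p⊓q≡q u≤p | p≥q⇒p⊓q≡q v≤p = p⊓q≤q p (u + v)

module _ {A : Set} where

  sumℚ-mono-≤ : ∀ {f g : A → ℚ} → (∀ x → f x ≤ g x) → ∀ xs →
                sumℚ (map f xs) ≤ sumℚ (map g xs)
  sumℚ-mono-≤ f≤g []       = ≤-refl
  sumℚ-mono-≤ f≤g (x ∷ xs) = +-mono-≤ (f≤g x) (sumℚ-mono-≤ f≤g xs)

  sumℚ-nonNeg : ∀ {f : A → ℚ} → (∀ x → 0ℚ ≤ f x) → ∀ xs → 0ℚ ≤ sumℚ (map f xs)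
  sumℚ-nonNeg 0≤f []       = ≤-refl
  sumℚ-nonNeg 0≤f (x ∷ xs) = +-mono-≤ (0≤f x) (sumℚ-nonNeg 0≤f xs)

  sumℚ-ℕtoℚ-* : ∀ (f : A → ℕ) q xs →
                sumℚ (map (λ x → ℕtoℚ (f x) * q) xs) ≡ ℕtoℚ (sum (map f xs)) * q
  sumℚ-ℕtoℚ-* f q []       = sym (*-zeroˡ q)
  sumℚ-ℕtoℚ-* f q (x ∷ xs) = begin
    ℕtoℚ (f x) * q + sumℚ (map (λ x → ℕtoℚ (f x) * q) xs)
      ≡⟨ cong (λ s → ℕtoℚ (f x) * q + s) (sumℚ-ℕtoℚ-* f q xs) ⟩
    ℕtoℚ (f x) * q + ℕtoℚ (sum (map f xs)) * q
      ≡⟨ *-distribʳ-+ q (ℕtoℚ (f x)) _ ⟨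
    (ℕtoℚ (f x) + ℕtoℚ (sum (map f xs))) * q
      ≡⟨ cong (_* q) (ℕtoℚ-+ (f x) _) ⟨
    ℕtoℚ (f x ℕ.+ sum (map f xs)) * q
      ∎
    where open ≡-Reasoning

  sumℚ-⊓-subadditive : ∀ {p} {f : A → ℚ} → 0ℚ ≤ p → (∀ x → 0ℚ ≤ f x) → ∀ xs →
                       p ⊓ sumℚ (map f xs) ≤ sumℚ (map (λ x → p ⊓ f x) xs)
  sumℚ-⊓-subadditive {p} 0≤p 0≤f []       = p⊓q≤q p 0ℚ
  sumℚ-⊓-subadditive {p} {f} 0≤p 0≤f (x ∷ xs) =
    ≤-trans (⊓-subadditive 0≤p (0≤f x) (sumℚ-nonNeg 0≤f xs))
            (+-monoʳ-≤ (p ⊓ f x) (sumℚ-⊓-subadditive 0≤p 0≤f xs))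

indicator : Bool → ℕ
indicator b = if b then 1 else 0

sum-map-+ : ∀ {A : Set} (f g : A → ℕ) xs →
            sum (map (λ x → f x ℕ.+ g x) xs) ≡ sum (map f xs) ℕ.+ sum (map g xs)
sum-map-+ f g []       = refl
sum-map-+ f g (x ∷ xs) = trans (cong ((f x ℕ.+ g x) ℕ.+_) (sum-map-+ f g xs))
                               (interchange (f x) (g x) (sum (map f xs)) (sum (map g xs)))

masked : ∀ {C : Set} → (C → Bool) → (C → ℕ) → C → ℕ
masked t f c = if t c then f c else 0

module _ {A C : Set} (_≟_ : DecidableEquality C) (key : A → C) where

  multiplicity : List A → C → ℕ
  multiplicity es c = length (filter (λ e → key e ≟ c) es)

  sum-indicator-∉ : ∀ t k {L} → All (k ≢_) L →
                    sum (map (masked t (indicator ∘ does ∘ (k ≟_))) L) ≡ 0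
  sum-indicator-∉ t k []            = refl
  sum-indicator-∉ t k {c ∷ L} (k≢c ∷ k∉L) with k ≟ c | t c
  ... | yes k≡c | _     = contradiction k≡c k≢c
  ... | no _    | true  = sum-indicator-∉ t k k∉L
  ... | no _    | false = sum-indicator-∉ t k k∉L

  sum-indicator-∈ : ∀ t k {L} → Unique L → k ∈ L →
                    sum (map (masked t (indicator ∘ does ∘ (k ≟_))) L) ≡ indicator (t k)
  sum-indicator-∈ t k {c ∷ L} (k∉L ∷ _) (here refl) with k ≟ k | t k
  ... | no k≢k | _     = contradiction refl k≢k
  ... | yes _  | true  = cong suc (sum-indicator-∉ t k k∉L)
  ... | yes _  | false = sum-indicator-∉ t k k∉L
  sum-indicator-∈ t k {c ∷ L} (c∉L ∷ L!) (there k∈L) with k ≟ c | t c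
  ... | yes refl | _     = contradiction refl (All.lookup c∉L k∈L)
  ... | no _     | true  = sum-indicator-∈ t k L! k∈L
  ... | no _     | false = sum-indicator-∈ t k L! k∈L

  sum-multiplicity : ∀ {L} → Unique L → ∀ es → (∀ {e} → e ∈ es → key e ∈ L) → ∀ t →
                     sum (map (masked t (multiplicity es)) L) ≡ length (filterᵇ (t ∘ key) es)
  sum-multiplicity {L} _ [] _ t = sum-zero L
    where
    sum-zero : ∀ L → sum (map (masked t (multiplicity [])) L) ≡ 0
    sum-zero []      = refl
    sum-zero (c ∷ L) with t c
    ... | true  = sum-zero L
    ... | false = sum-zero L
  sum-multiplicity {L} L! (e ∷ es) keys∈L t = begin
    sum (map (masked t (multiplicity (e ∷ es))) L)
      ≡⟨ cong sum (map-cong split L) ⟩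
    sum (map (λ c → masked t δ c ℕ.+ masked t (multiplicity es) c) L)
      ≡⟨ sum-map-+ (masked t δ) (masked t (multiplicity es)) L ⟩
    sum (map (masked t δ) L) ℕ.+ sum (map (masked t (multiplicity es)) L)
      ≡⟨ cong₂ ℕ._+_ (sum-indicator-∈ t (key e) L! (keys∈L (here refl)))
                   (sum-multiplicity L! es (keys∈L ∘ there) t) ⟩
    indicator (t (key e)) ℕ.+ length (filterᵇ (t ∘ key) es)
      ≡⟨ length-filterᵇ-∷ ⟩
    length (filterᵇ (t ∘ key) (e ∷ es))
      ∎
    where
    open ≡-Reasoning
    δ : C → ℕ
    δ = indicator ∘ does ∘ (key e ≟_)
    split : ∀ c → masked t (multiplicity (e ∷ es)) c
                  ≡ masked t δ c ℕ.+ masked t (multiplicity es) c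
    split c with key e ≟ c | t c
    ... | yes _ | true  = refl
    ... | yes _ | false = refl
    ... | no _  | true  = refl
    ... | no _  | false = refl
    length-filterᵇ-∷ : indicator (t (key e)) ℕ.+ length (filterᵇ (t ∘ key) es)
                     ≡ length (filterᵇ (t ∘ key) (e ∷ es))
    length-filterᵇ-∷ with t (key e)
    ... | true  = refl
    ... | false = refl

concatMap-map≡cartesianProductWith : ∀ {A B C : Set} (f : A → B → C) xs ys →
  concatMap (λ x → map (f x) ys) xs ≡ cartesianProductWith f xs ys
concatMap-map≡cartesianProductWith f []       ys = refl
concatMap-map≡cartesianProductWith f (x ∷ xs) ys =
  cong (map (f x) ys ++_) (concatMap-map≡cartesianProductWith f xs ys)

allSubsets-suc : ∀ n →
  allSubsets (suc n) ≡ cartesianProductWith (flip _∷_) (allSubsets n) (true ∷ false ∷ [])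
allSubsets-suc n = concatMap-map≡cartesianProductWith (flip _∷_) (allSubsets n) (true ∷ false ∷ [])

∈-allSubsets : ∀ n (s : Subset n) → s ∈ allSubsets n
∈-allSubsets zero    []      = here refl
∈-allSubsets (suc n) (b ∷ s) rewrite allSubsets-suc n =
  ∈-cartesianProductWith⁺ (flip _∷_) (∈-allSubsets n s) (∈-bools b)
  where
  ∈-bools : ∀ b → b ∈ true ∷ false ∷ []
  ∈-bools true  = here refl
  ∈-bools false = there (here refl)

allSubsets-unique : ∀ n → Unique (allSubsets n)
allSubsets-unique zero    = [] ∷ []
allSubsets-unique (suc n) rewrite allSubsets-suc n =
  cartesianProductWith⁺ (flip _∷_) (λ eq → Vec.∷-injectiveʳ eq , Vec.∷-injectiveˡ eq)
    (allSubsets-unique n) (((λ ()) ∷ []) ∷ [] ∷ [])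

module _ {m n} (K : BMat m n) where

  private
    allRects≡ : concatMap (λ R → map (λ C → (R , C)) (allSubsets n)) (allSubsets m)
              ≡ cartesianProduct (allSubsets m) (allSubsets n)
    allRects≡ = concatMap-map≡cartesianProductWith _,_ (allSubsets m) (allSubsets n)

  rects-unique : Unique (rects K)
  rects-unique = filter⁺ _ (subst Unique (sym allRects≡)
    (cartesianProduct⁺ (allSubsets-unique m) (allSubsets-unique n)))

  ∈-rects : ∀ {R C} → is1Rect K R C ≡ true → (R , C) ∈ rects K
  ∈-rects {R} {C} isRect = ∈-filter⁺ _ (subst ((R , C) ∈_) (sym allRects≡)
    (∈-cartesianProduct⁺ (∈-allSubsets m R) (∈-allSubsets n C))) isRect

covers : ∀ {m n} → Fin m → Fin n → Subset m × Subset n → Bool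
covers i j rc = lookup (proj₁ rc) i ∧ lookup (proj₂ rc) j

all-true : ∀ {A : Set} {p : A → Bool} → (∀ x → p x ≡ true) → ∀ xs → all p xs ≡ true
all-true p≡true []       = refl
all-true p≡true (x ∷ xs) rewrite p≡true x = all-true p≡true xs

is1Rect-intro : ∀ {m n} {K : BMat m n} {R C} →
  (∀ i j → lookup R i ≡ true → lookup C j ≡ true → K i j ≡ true) → is1Rect K R C ≡ true
is1Rect-intro {m} {n} {K} {R} {C} inside =
  all-true (λ i → all-true (λ j → cell i j) (allFin n)) (allFin m)
  where
  cell : ∀ i j → not (lookup R i ∧ lookup C j) ∨ K i j ≡ true
  cell i j with lookup R i in i∈R | lookup C j in j∈C
  ... | false | _     = refl
  ... | true  | false = refl
  ... | true  | true  = inside i j i∈R j∈C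

-- Reachability in finite acyclic graphs

module _ {k : ℕ} (es : List (Fin k × Fin k)) where

  private
    E : Fin k → Fin k → Set
    E u w = (u , w) ∈ es

  steps : ∀ {x y} → Star E x y → ℕ
  steps ε       = 0
  steps (_ ◅ p) = suc (steps p)

  Reach≤ : ℕ → Fin k → Fin k → Set
  Reach≤ zero    x y = x ≡ y
  Reach≤ (suc ℓ) x y = x ≡ y ⊎ Any (λ e → proj₁ e ≡ x × Reach≤ ℓ (proj₂ e) y) es

  reach≤? : ∀ ℓ → Decidable (Reach≤ ℓ)
  reach≤? zero    x y = x Fin.≟ y
  reach≤? (suc ℓ) x y =
    x Fin.≟ y ⊎-dec any? (λ e → proj₁ e Fin.≟ x ×-dec reach≤? ℓ (proj₂ e) y) es

  Reach≤⇒Star : ∀ ℓ {x y} → Reach≤ ℓ x y → Star E x y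
  Reach≤⇒Star zero    refl        = ε
  Reach≤⇒Star (suc ℓ) (inj₁ refl) = ε
  Reach≤⇒Star (suc ℓ) (inj₂ first-edge) with find first-edge
  ... | _ , e∈es , refl , rest = e∈es ◅ Reach≤⇒Star ℓ rest

  Star⇒Reach≤ : ∀ {ℓ x y} (p : Star E x y) → steps p ℕ.≤ ℓ → Reach≤ ℓ x y
  Star⇒Reach≤ {zero}  ε       _         = refl
  Star⇒Reach≤ {suc ℓ} ε       _         = inj₁ refl
  Star⇒Reach≤ {suc ℓ} (e ◅ p) (s≤s p≤ℓ) = inj₂ (lose e (refl , Star⇒Reach≤ p p≤ℓ))

  vertexAt : ∀ {x y} → Star E x y → ℕ → Fin k
  vertexAt {x} ε       _       = x
  vertexAt {x} (_ ◅ _) zero    = x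
  vertexAt     (_ ◅ p) (suc i) = vertexAt p i

  prefix : ∀ {x y} (p : Star E x y) i → Star E x (vertexAt p i)
  prefix ε       _       = ε
  prefix (_ ◅ _) zero    = ε
  prefix (e ◅ p) (suc i) = e ◅ prefix p i

  _◅⁺_ : ∀ {x y z} → E x y → Star E y z → TransClosure E x z
  e ◅⁺ ε       = [ e ]
  e ◅⁺ (f ◅ p) = e ∷ (f ◅⁺ p)

  segment : ∀ {x y} (p : Star E x y) {i j} → i ℕ.< j → j ℕ.≤ steps p →
            TransClosure E (vertexAt p i) (vertexAt p j)
  segment (e ◅ p) {zero}  {suc j} _         _         = e ◅⁺ prefix p j
  segment (_ ◅ p) {suc i} {suc j} (s≤s i<j) (s≤s j≤n) = segment p i<j j≤n

  -- A vertex repeated along a walk would close a cycle, so in an acyclic graph every walk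
  -- has fewer than k steps and reachability is decided by bounded-length reachability.
  module _ (acyclic : ∀ u → ¬ TransClosure E u u) where

    steps< : ∀ {x y} (p : Star E x y) → steps p ℕ.< k
    steps< p with steps p ℕ.<? k
    ... | yes p<k = p<k
    ... | no  p≮k with Fin.pigeonhole (s≤s (ℕ.≮⇒≥ p≮k)) (λ i → vertexAt p (toℕ i))
    ...   | i , j , i<j , same = contradiction
              (subst (λ v → TransClosure E v (vertexAt p (toℕ j))) same
                     (segment p i<j (ℕ.≤-pred (Fin.toℕ<n j))))
              (acyclic _)

    Star? : Decidable (Star E)
    Star? x y =
      map′ (Reach≤⇒Star k) (λ p → Star⇒Reach≤ p (ℕ.<⇒≤ (steps< p))) (reach≤? k x y)

TransClosure-map : ∀ {A : Set} {R S : A → A → Set} → (∀ {x y} → R x y → S x y) →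
                   ∀ {x y} → TransClosure R x y → TransClosure S x y
TransClosure-map f [ r ]   = [ f r ]
TransClosure-map f (r ∷ p) = f r ∷ TransClosure-map f p

module _ {m n} (N : Network m n) (keep : Fin (nv N) × Fin (nv N) → Bool) where

  Kept : Fin (nv N) → Fin (nv N) → Set
  Kept u w = (u , w) ∈ filterᵇ keep (edges N)

  Kept⇒Edge : ∀ {u w} → Kept u w → Edge N u w
  Kept⇒Edge = proj₁ ∘ ∈-filter⁻ (T? ∘ keep)

  restrict : ∀ {m′ n′} (outs : Fin m′ → Fin m) (ins : Fin n′ → Fin n) →
             Injective _≡_ _≡_ outs → Injective _≡_ _≡_ ins → Network m′ n′
  restrict outs ins outs-injective ins-injective = record
    { nv      = nv N
    ; edges   = filterᵇ keep (edges N)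
    ; uniqueE = filter⁺ (T? ∘ keep) (uniqueE N)
    ; acyclic = λ u cycle → acyclic N u (TransClosure-map Kept⇒Edge cycle)
    ; inp     = inp N ∘ ins
    ; out     = out N ∘ outs
    ; inpInj  = ins-injective ∘ inpInj N
    ; outInj  = outs-injective ∘ outInj N
    ; inpSrc  = λ j u e → inpSrc N (ins j) u (Kept⇒Edge e)
    ; outSnk  = λ i w e → outSnk N (outs i) w (Kept⇒Edge e)
    }

  Star-keep : ∀ {x y} →
    (∀ {u w} → Star (Edge N) x u → Edge N u w → Star (Edge N) w y → keep (u , w) ≡ true) →
    Star (Edge N) x y → Star Kept x y
  Star-keep {x} {y} kept = go ε
    where
    go : ∀ {u} → Star (Edge N) x u → Star (Edge N) u y → Star Kept u y
    go before ε             = ε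
    go before (e ◅ after) =
      ∈-filter⁺ (T? ∘ keep) e (Equivalence.from Bool.T-≡ (kept before e after))
        ◅ go (before ◅◅ e ◅ ε) after

-- Slices of a network for K ⊗ M

lookup-tabulate-does : ∀ {k} {P : Fin k → Set} (P? : ∀ i → Dec (P i)) i →
                       lookup (tabulate (does ∘ P?)) i ≡ true ⇔ P i
lookup-tabulate-does {P = P} P? i rewrite Vec.lookup∘tabulate (does ∘ P?) i =
  mk⇔ witness (dec-true (P? i))
  where
  witness : does (P? i) ≡ true → P i
  witness with P? i
  ... | yes p = λ _ → p
  ... | no  _ = λ ()

⊗-combine : ∀ {m₁ n₁ m₂ n₂} (K : BMat m₁ n₁) (M : BMat m₂ n₂) i₁ i₂ j₁ j₂ →
            (K ⊗ M) (combine i₁ i₂) (combine j₁ j₂) ≡ K i₁ j₁ ∧ M i₂ j₂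
⊗-combine {m₁} {n₁} {m₂} {n₂} K M i₁ i₂ j₁ j₂ =
  cong₂ (λ i j → K (proj₁ i) (proj₁ j) ∧ M (proj₂ i) (proj₂ j))
        (Fin.remQuot-combine {m₁} {m₂} i₁ i₂) (Fin.remQuot-combine {n₁} {n₂} j₁ j₂)

module Slices {m₁ n₁ m₂ n₂} (K : BMat m₁ n₁) (M : BMat m₂ n₂)
              (N : Network (m₁ *ℕ m₂) (n₁ *ℕ n₂)) (N⟦K⊗M⟧ : Expresses N (K ⊗ M)) where

  private
    V : Set
    V = Fin (nv N)

    _⇝_ : V → V → Set
    _⇝_ = Star (Edge N)

    _⇝?_ : Decidable _⇝_
    _⇝?_ = Star? (edges N) (acyclic N)

    inp₂ : Fin n₁ → Fin n₂ → V
    inp₂ j₁ j₂ = inp N (combine j₁ j₂)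

    out₂ : Fin m₁ → Fin m₂ → V
    out₂ i₁ i₂ = out N (combine i₁ i₂)

  ⊗-walk⇔ : ∀ i₁ i₂ j₁ j₂ → (K i₁ j₁ ∧ M i₂ j₂ ≡ true) ⇔ inp₂ j₁ j₂ ⇝ out₂ i₁ i₂
  ⊗-walk⇔ i₁ i₂ j₁ j₂ = subst (λ b → (b ≡ true) ⇔ _) (⊗-combine K M i₁ i₂ j₁ j₂)
                              (N⟦K⊗M⟧ (combine i₁ i₂) (combine j₁ j₂))

  edgeRect : V × V → Subset m₁ × Subset n₁
  edgeRect (u , w) = tabulate (does ∘ λ i₁ → Fin.any? λ i₂ → w ⇝? out₂ i₁ i₂)
                   , tabulate (does ∘ λ j₁ → Fin.any? λ j₂ → inp₂ j₁ j₂ ⇝? u)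

  private
    row∈edgeRect : ∀ {u w i₁} →
                   lookup (proj₁ (edgeRect (u , w))) i₁ ≡ true ⇔ ∃ λ i₂ → w ⇝ out₂ i₁ i₂
    row∈edgeRect {u} {w} {i₁} = lookup-tabulate-does (λ i₁ → Fin.any? λ i₂ → w ⇝? out₂ i₁ i₂) i₁

    col∈edgeRect : ∀ {u w j₁} →
                   lookup (proj₂ (edgeRect (u , w))) j₁ ≡ true ⇔ ∃ λ j₂ → inp₂ j₁ j₂ ⇝ u
    col∈edgeRect {u} {w} {j₁} = lookup-tabulate-does (λ j₁ → Fin.any? λ j₂ → inp₂ j₁ j₂ ⇝? u) j₁

  edgeRect-is1Rect : ∀ {e} → e ∈ edges N →
                     is1Rect K (proj₁ (edgeRect e)) (proj₂ (edgeRect e)) ≡ true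
  edgeRect-is1Rect {u , w} u→w =
    is1Rect-intro {K = K} {proj₁ (edgeRect (u , w))} {proj₂ (edgeRect (u , w))} λ i₁ j₁ i₁∈R j₁∈C →
      let i₂ , w⇝out = Equivalence.to (row∈edgeRect {u}) i₁∈R
          j₂ , inp⇝u = Equivalence.to (col∈edgeRect {w = w}) j₁∈C
      in Bool.∧-conicalˡ (K i₁ j₁) (M i₂ j₂)
           (Equivalence.from (⊗-walk⇔ i₁ i₂ j₁ j₂) (inp⇝u ◅◅ u→w ◅ w⇝out))

  slice : Fin m₁ → Fin n₁ → Network m₂ n₂
  slice i₁ j₁ = restrict N (covers i₁ j₁ ∘ edgeRect) (combine i₁) (combine j₁)
    (Fin.combine-injectiveʳ i₁ _ i₁ _) (Fin.combine-injectiveʳ j₁ _ j₁ _)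

  slice-expresses : ∀ i₁ j₁ → K i₁ j₁ ≡ true → Expresses (slice i₁ j₁) M
  slice-expresses i₁ j₁ Kij i₂ j₂ = mk⇔
    (λ Mij → Star-keep N _ covered (Equivalence.to (⊗-walk⇔ i₁ i₂ j₁ j₂) (cong₂ _∧_ Kij Mij)))
    (λ walk → Bool.∧-conicalʳ _ _
                (Equivalence.from (⊗-walk⇔ i₁ i₂ j₁ j₂) (Star.map (Kept⇒Edge N _) walk)))
    where
    covered : ∀ {u w} → inp₂ j₁ j₂ ⇝ u → Edge N u w → w ⇝ out₂ i₁ i₂ →
              covers i₁ j₁ (edgeRect (u , w)) ≡ true
    covered {u} {w} inp⇝u _ w⇝out = cong₂ _∧_
      (Equivalence.from (row∈edgeRect {u}) (i₂ , w⇝out))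
      (Equivalence.from (col∈edgeRect {w = w}) (j₂ , inp⇝u))

-- The fractional cover given by a multiset of 1-rectangles

module _ {m n} (K : BMat m n) {A : Set} (rect : A → Subset m × Subset n) (es : List A)
         (rect-is1Rect : ∀ {e} → e ∈ es → is1Rect K (proj₁ (rect e)) (proj₂ (rect e)) ≡ true)
         where

  private
    _≟ᵣ_ : DecidableEquality (Subset m × Subset n)
    _≟ᵣ_ = Product.≡-dec (Vec.≡-dec Bool._≟_) (Vec.≡-dec Bool._≟_)

    mult : Subset m × Subset n → ℕ
    mult = multiplicity _≟ᵣ_ rect es

    sum-mult : ∀ t → sum (map (masked t mult) (rects K)) ≡ length (filterᵇ (t ∘ rect) es)
    sum-mult = sum-multiplicity _≟ᵣ_ rect (rects-unique K) es (∈-rects K ∘ rect-is1Rect)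

    mult/[1+_] : ℕ → Subset m × Subset n → ℚ
    mult/[1+ b ] c = ℕtoℚ (mult c) * 1/[1+ b ]

    0≤mult/[1+_] : ∀ b c → 0ℚ ≤ mult/[1+ b ] c
    0≤mult/[1+ b ] c = begin
      0ℚ                  ≡⟨ *-zeroˡ 1/[1+ b ] ⟨
      0ℚ * 1/[1+ b ]      ≤⟨ *-monoʳ-≤-nonNeg 1/[1+ b ] (0≤ℕtoℚ (mult c)) ⟩
      mult/[1+ b ] c      ∎
      where open ≤-Reasoning

  coverWeights : ℕ → Weights m n
  coverWeights b R C = 1ℚ ⊓ mult/[1+ b ] (R , C)

  coverWeights-objective : ∀ b → objective K (coverWeights b) ≤ ℕtoℚ (length es) * 1/[1+ b ]
  coverWeights-objective b = begin
    sumℚ (map (λ c → 1ℚ ⊓ mult/[1+ b ] c) (rects K))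
      ≤⟨ sumℚ-mono-≤ (λ c → p⊓q≤q 1ℚ (mult/[1+ b ] c)) (rects K) ⟩
    sumℚ (map mult/[1+ b ] (rects K))
      ≡⟨ sumℚ-ℕtoℚ-* mult 1/[1+ b ] (rects K) ⟩
    ℕtoℚ (sum (map mult (rects K))) * 1/[1+ b ]
      ≡⟨ cong (λ k → ℕtoℚ k * 1/[1+ b ]) (sum-mult (λ _ → true)) ⟩
    ℕtoℚ (length (filterᵇ (λ _ → true) es)) * 1/[1+ b ]
      ≤⟨ *-monoʳ-≤-nonNeg 1/[1+ b ] (ℕtoℚ-mono-≤ (length-filter (T? ∘ (λ _ → true)) es)) ⟩
    ℕtoℚ (length es) * 1/[1+ b ]
      ∎
    where open ≤-Reasoning

  coverWeights-feasible : ∀ b →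
    (∀ i j → K i j ≡ true → suc b ℕ.≤ length (filterᵇ (covers i j ∘ rect) es)) →
    Feasible K (coverWeights b)
  coverWeights-feasible b covered =
    (λ c _ → ⊓-glb (nonNegative⁻¹ 1ℚ) (0≤mult/[1+ b ] c) , p⊓q≤p 1ℚ (mult/[1+ b ] c)) , coverage
    where
    coverage : ∀ i j → K i j ≡ true →
      1ℚ ≤ sumℚ (map (λ c → if covers i j c then 1ℚ ⊓ mult/[1+ b ] c else 0ℚ) (rects K))
    coverage i j Kij = begin
      1ℚ
        ≤⟨ ⊓-glb ≤-refl 1≤∑g ⟩
      1ℚ ⊓ sumℚ (map g (rects K))
        ≤⟨ sumℚ-⊓-subadditive (nonNegative⁻¹ 1ℚ) 0≤g (rects K) ⟩
      sumℚ (map (λ c → 1ℚ ⊓ g c) (rects K))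
        ≤⟨ sumℚ-mono-≤ ⊓-masked (rects K) ⟩
      sumℚ (map (λ c → if t c then 1ℚ ⊓ mult/[1+ b ] c else 0ℚ) (rects K))
        ∎
      where
      open ≤-Reasoning
      t : Subset m × Subset n → Bool
      t = covers i j

      g : Subset m × Subset n → ℚ
      g c = if t c then mult/[1+ b ] c else 0ℚ

      ℕtoℚ-masked : ∀ c → ℕtoℚ (masked t mult c) * 1/[1+ b ] ≡ g c
      ℕtoℚ-masked c with t c
      ... | true  = refl
      ... | false = *-zeroˡ 1/[1+ b ]

      0≤g : ∀ c → 0ℚ ≤ g c
      0≤g c with t c
      ... | true  = 0≤mult/[1+ b ] c
      ... | false = ≤-refl

      ⊓-masked : ∀ c → 1ℚ ⊓ g c ≤ (if t c then 1ℚ ⊓ mult/[1+ b ] c else 0ℚ)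
      ⊓-masked c with t c
      ... | true  = ≤-refl
      ... | false = p⊓q≤q 1ℚ 0ℚ

      1≤∑g : 1ℚ ≤ sumℚ (map g (rects K))
      1≤∑g = begin
        1ℚ
          ≡⟨ ℕtoℚ[1+n]*1/[1+n]≡1 b ⟨
        ℕtoℚ (suc b) * 1/[1+ b ]
          ≤⟨ *-monoʳ-≤-nonNeg 1/[1+ b ] (ℕtoℚ-mono-≤ (covered i j Kij)) ⟩
        ℕtoℚ (length (filterᵇ (t ∘ rect) es)) * 1/[1+ b ]
          ≡⟨ cong (λ k → ℕtoℚ k * 1/[1+ b ]) (sum-mult t) ⟨
        ℕtoℚ (sum (map (masked t mult) (rects K))) * 1/[1+ b ]
          ≡⟨ sumℚ-ℕtoℚ-* (masked t mult) 1/[1+ b ] (rects K) ⟨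
        sumℚ (map (λ c → ℕtoℚ (masked t mult c) * 1/[1+ b ]) (rects K))
          ≡⟨ cong sumℚ (map-cong ℕtoℚ-masked (rects K)) ⟩
        sumℚ (map g (rects K))
          ∎

  fracRank*b≤length : ∀ {r b} → IsFracRank K r →
    (∀ i j → K i j ≡ true → b ℕ.≤ length (filterᵇ (covers i j ∘ rect) es)) →
    r * ℕtoℚ b ≤ ℕtoℚ (length es)
  fracRank*b≤length {r} {zero} _ _ = ≤-trans (≤-reflexive (*-zeroʳ r)) (0≤ℕtoℚ (length es))
  fracRank*b≤length {r} {suc b} (_ , r-minimal) covered = ≤*1/[1+n]⇒*[1+n]≤ b (begin
    r                              ≤⟨ r-minimal (coverWeights b) (coverWeights-feasible b covered) ⟩
    objective K (coverWeights b)   ≤⟨ coverWeights-objective b ⟩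
    ℕtoℚ (length es) * 1/[1+ b ]   ∎)
    where open ≤-Reasoning

theorem12 : ∀ {m₁ n₁ m₂ n₂} (K : BMat m₁ n₁) (M : BMat m₂ n₂)
              (r : ℚ) (a b : ℕ) →
              IsFracRank K r → IsOR M b → IsOR (K ⊗ M) a →
              r * ℕtoℚ b ≤ ℕtoℚ a
theorem12 K M r a b rk*K (_ , b≤OR) ((N , N⟦K⊗M⟧ , refl) , _) =
  fracRank*b≤length K edgeRect (edges N) edgeRect-is1Rect rk*K
    λ i j Kij → b≤OR (slice i j) (slice-expresses i j Kij)
  where open Slices K M N N⟦K⊗M⟧
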